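{- The product and coproduct defined below form a graded bialgebra structure on $\widetilde{\Delta Sym}$, and therefore $\widetilde{\Delta Sym}$ is a (one-sided) Hopf algebra.
   Context: Let $E_n$ be the edgeless graph on nodes $1,\dots,n$. Its tubes are the singletons and the universal tube $[n]$; a tubing of $E_n$ is $[n]$ together with a set of singletons not containing all $n$ singletons. Let $\emptyset_n$ denote the collection of all $n$ singletons together with $[n]$ (the null face), and let $\mathcal{D}_n$ be the set of tubings of $E_n$ together with $\emptyset_n$ (so $|\mathcal{D}_n|=2^n$). $\widetilde{\Delta Sym}$ is the graded $\mathbb{Q}$-vector space with degree-$n$ basis $\{F_u:u\in\mathcal{D}_n\}$ and basis element $1$ in degree 0. $S^{(p,q)}$ is the set of permutations $\iota$ of $[p+q]$ with $\iota(1)<\dots<\iota(p)$ and $\iota(p+1)<\dots<\iota(p+q)$; $\hat\iota(i)=\iota(p+i)$. Product: for $u\in\mathcal{D}_p$, $v\in\mathcal{D}_q$ with $p,q\ge1$, $F_u\cdot F_v=\sum_{\iota\in S^{(p,q)}}F_{w_\iota}$, where $w_\iota\in\mathcal{D}_{p+q}$ consists of the singletons $\{\iota(i)\}$, $i\in[p]$, the tubes $\hat\iota(t)$ for non-universal $t\in v$, and $[p+q]$; moreover $1\cdot F_u=F_u$ and $F_u\cdot 1=F_{\emptyset_p}$. Coproduct: for $u\in\mathcal{D}_n$, $\Delta(F_u)=\sum_{i=0}^nF_{u_i}\otimes F_{u_{n-i}}$, where $u_i$ is the restriction of $u$ to the subgraph on nodes $1,\dots,i$ (the nonempty intersections of tubes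 of $u$ with $\{1,\dots,i\}$) and $u_{n-i}$ is the restriction to nodes $i+1,\dots,n$ (nonempty intersections of tubes of $u$ with $\{i+1,\dots,n\}$, renumbered as $1,\dots,n-i$), with $F_{u_0}=1$ and $F_{u_{n-n}}=1$ for the empty restrictions. -}

module Defs where

open import Data.Bool using (Bool; true; false)
open import Data.Bool.Properties using () renaming (_≟_ to _≟B_)
open import Data.Nat using (ℕ; zero; suc; _+_)
open import Data.List using (List; []; _∷_; _++_; map; concatMap; foldr; replicate; length; take; drop; upTo)
open import Data.List.Relation.Unary.All using (All)
import Data.List.Properties as LP
import Data.Product.Properties as PP
open import Data.Product using (Σ; ∃; _×_; _,_)
open import Data.Rational using (ℚ; 0ℚ; 1ℚ) renaming (_+_ to _+ℚ_; _*_ to _*ℚ_)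
open import Relation.Nullary using (yes; no)
open import Relation.Binary.Definitions using (DecidableEquality)
open import Relation.Binary.PropositionalEquality using (_≡_)

-- Finite formal ℚ-linear combinations (free ℚ-vector space on A)

FM : Set → Set
FM A = List (ℚ × A)

coeff : {A : Set} → DecidableEquality A → A → FM A → ℚ
coeff _≟_ a [] = 0ℚ
coeff _≟_ a ((c , b) ∷ xs) with a ≟ b
... | yes _ = c +ℚ coeff _≟_ a xs
... | no  _ = coeff _≟_ a xs

Eq : {A : Set} → DecidableEquality A → FM A → FM A → Set
Eq _≟_ x y = ∀ a → coeff _≟_ a x ≡ coeff _≟_ a y

lin : {A B : Set} → (A → FM B) → FM A → FM B
lin f = concatMap (λ { (c , a) → map (λ { (d , b) → (c *ℚ d , b) }) (f a) })

linℚ : {A : Set} → (A → ℚ) → FM A → ℚ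
linℚ f = foldr (λ { (c , a) r → (c *ℚ f a) +ℚ r }) 0ℚ

tens : {A B : Set} → FM A → FM B → FM (A × B)
tens x y = concatMap (λ { (c , a) → map (λ { (d , b) → (c *ℚ d , (a , b)) }) y }) x

basis : {A : Set} → A → FM A
basis a = (1ℚ , a) ∷ []

-- An element u ∈ 𝒟_n is encoded as a list of n booleans: position i is
-- true iff the singleton tube {i} belongs to u (the universal tube [n]
-- always belongs to u).  The all-true list encodes the null face ∅_n;
-- the other lists encode the tubings of E_n.  The empty list (n = 0)
-- encodes the degree-0 basis element 1.

Basis : Set
Basis = List Bool

deg : Basis → ℕ
deg = length

_≟Basis_ : DecidableEquality Basis
_≟Basis_ = LP.≡-dec _≟B_

_≟₂_ : DecidableEquality (Basis × Basis)
_≟₂_ = PP.≡-dec _≟Basis_ _≟Basis_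

_≟₃_ : DecidableEquality (Basis × Basis × Basis)
_≟₃_ = PP.≡-dec _≟Basis_ _≟₂_

V V₂ V₃ : Set
V  = FM Basis
V₂ = FM (Basis × Basis)
V₃ = FM (Basis × Basis × Basis)

_≈_ : V → V → Set
_≈_ = Eq _≟Basis_

_≈₂_ : V₂ → V₂ → Set
_≈₂_ = Eq _≟₂_

_≈₃_ : V₃ → V₃ → Set
_≈₃_ = Eq _≟₃_

one : V
one = basis []

-- A (p,q)-shuffle ι is determined by the interleaving of the
-- positions ι(1..p) and ι(p+1..p+q); `shuffles xs ys` lists, for every
-- ι ∈ S^(p,q) (each exactly once), the word w with w(ι(i)) = xs(i) and
-- w(ι(p+j)) = ys(j).

shuffles : {A : Set} → List A → List A → List (List A)
shuffles [] ys = ys ∷ []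
shuffles (x ∷ xs) [] = (x ∷ xs) ∷ []
shuffles (x ∷ xs) (y ∷ ys) =
  map (x ∷_) (shuffles xs (y ∷ ys)) ++ map (y ∷_) (shuffles (x ∷ xs) ys)

-- product on basis elements:
--   1 · F_u = F_u,   F_u · 1 = F_{∅_p},
--   F_u · F_v = Σ_{ι ∈ S^(p,q)} F_{w_ι}, where w_ι contains all
--   singletons {ι(i)}, i ∈ [p], and the singletons ι̂(t) for t ∈ v.
mulB : Basis → Basis → V
mulB [] v = basis v
mulB (x ∷ u) [] = basis (replicate (length (x ∷ u)) true)
mulB (x ∷ u) (y ∷ v) =
  map (λ w → (1ℚ , w)) (shuffles (replicate (length (x ∷ u)) true) (y ∷ v))

_·_ : V → V → V
x · y = lin (λ a → lin (mulB a) y) x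

ΔB : Basis → V₂
ΔB u = map (λ i → (1ℚ , (take i u , drop i u))) (upTo (suc (length u)))

Δ : V → V₂
Δ = lin ΔB

εB : Basis → ℚ
εB [] = 1ℚ
εB (_ ∷ _) = 0ℚ

ε : V → ℚ
ε = linℚ εB

η : ℚ → V
η c = (c , []) ∷ []

Δ⊗id : V₂ → V₃
Δ⊗id = lin (λ { (a , b) → map (λ { (c , (a₁ , a₂)) → (c , (a₁ , a₂ , b)) }) (ΔB a) })

id⊗Δ : V₂ → V₃
id⊗Δ = lin (λ { (a , b) → map (λ { (c , (b₁ , b₂)) → (c , (a , b₁ , b₂)) }) (ΔB b) })

ε⊗id : V₂ → V
ε⊗id = lin (λ { (a , b) → (εB a , b) ∷ [] })

id⊗ε : V₂ → V
id⊗ε = lin (λ { (a , b) → (εB b , a) ∷ [] })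

_·₂_ : V₂ → V₂ → V₂
X ·₂ Y = lin (λ { (a , b) → lin (λ { (c , d) → tens (mulB a c) (mulB b d) }) Y }) X

id⋆ : (Basis → V) → V → V
id⋆ s x = lin (λ { (a , b) → lin (mulB a) (s b) }) (Δ x)

-- Graded bialgebra axioms (with the one-sided unit 1, which is a left
-- unit only) and the one-sided Hopf property.

record GradedBialgebra : Set where
  field
    mul-graded  : ∀ u v → All (λ { (c , w) → deg w ≡ deg u + deg v }) (mulB u v)
    Δ-graded    : ∀ u → All (λ { (c , (a , b)) → deg a + deg b ≡ deg u }) (ΔB u)
    mul-assoc   : ∀ x y z → ((x · y) · z) ≈ (x · (y · z))
    unit-left   : ∀ x → (one · x) ≈ x
    Δ-coassoc   : ∀ x → Δ⊗id (Δ x) ≈₃ id⊗Δ (Δ x)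
    counit-left  : ∀ x → ε⊗id (Δ x) ≈ x
    counit-right : ∀ x → id⊗ε (Δ x) ≈ x
    Δ-mul       : ∀ x y → Δ (x · y) ≈₂ (Δ x ·₂ Δ y)
    Δ-one       : Δ one ≈₂ tens one one
    ε-mul       : ∀ x y → ε (x · y) ≡ ε x *ℚ ε y
    ε-one       : ε one ≡ 1ℚ

HasOneSidedAntipode : Set
HasOneSidedAntipode = ∃ λ (s : Basis → V) → ∀ x → id⋆ s x ≈ η (ε x)

module Submission where

-- Two facts put everything
-- in terms of words: F_u · F_v is the sum of the shuffles of the null face
-- ∅_{deg u} with v (mulB-shuffles), and Δ is deconcatenation (ΔB-splits).
-- Associativity, coassociativity and Δ(xy) = Δ(x)Δ(y) thus become the
-- classical identities for shuffles and deconcatenations (shuffle-assoc,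
-- splits-coassoc, splits-shuffles), proved as equalities of lists of words
-- up to permutation.  They pass from basis elements to all vectors by
-- linear algebra on formal combinations compared coefficientwise (module
-- Combinations: linear and bilinear maps are determined on the basis).
-- The counit laws and ε(xy) = ε(x)ε(y) are direct computations, and the
-- antipode is given by the recursion S(F_u) = − Σ_{u = ab, a ≠ []} F_a S(F_b).

open import Defs
open import Data.Bool using (true)
open import Data.Nat using (suc; _+_)
import Data.Nat.Properties as ℕP
open import Data.List
  using (List; []; _∷_; _++_; [_]; map; concatMap; cartesianProduct; length; replicate; take; drop; applyUpTo)
import Data.List.Properties as LP
open import Data.List.Relation.Unary.All as All using (All; []; _∷_)
import Data.List.Relation.Unary.All.Properties as AllP
open import Data.List.Relation.Binary.Permutation.Propositional
  using (_↭_; ↭-refl; ↭-reflexive; module PermutationReasoning)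
open import Data.List.Relation.Binary.Permutation.Propositional.Properties
  using (++⁺ˡ; ++⁺; map⁺; shifts)
open import Data.Product using (_×_; _,_; proj₁; proj₂)
open import Data.Rational using (ℚ; 0ℚ; 1ℚ; -_) renaming (_+_ to _+ℚ_; _*_ to _*ℚ_)
import Data.Rational.Properties as ℚP
open import Data.Rational.Solver using (module +-*-Solver)
open import Function using (_∘_)
open import Relation.Binary.Bundles using (Setoid)
open import Relation.Binary.Definitions using (DecidableEquality)
open import Relation.Binary.PropositionalEquality
  using (_≡_; refl; sym; trans; cong; cong₂; subst; module ≡-Reasoning)
import Relation.Binary.Reasoning.Setoid as SetoidReasoning
open import Relation.Nullary using (yes; no)

open +-*-Solver using (solve; _:=_; _:+_; _:*_; con)

private variable A B C : Set

scale : ℚ → FM A → FM A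
scale c = map (λ t → (c *ℚ proj₁ t , proj₂ t))

neg : FM A → FM A
neg = scale (- 1ℚ)

ones : List A → FM A
ones = map (1ℚ ,_)

-- A bilinear map, given by its values on pairs of basis elements;
-- both products, · and ·₂, are of this form.
bilin : (A → B → FM C) → FM A → FM B → FM C
bilin f x y = lin (λ a → lin (f a) y) x

linℚ-cong : ∀ {g h : A → ℚ} → (∀ a → g a ≡ h a) → ∀ x → linℚ g x ≡ linℚ h x
linℚ-cong eq []            = refl
linℚ-cong eq ((c , a) ∷ x) = cong₂ (λ u v → c *ℚ u +ℚ v) (eq a) (linℚ-cong eq x)

linℚ-++ : ∀ (g : A → ℚ) xs ys → linℚ g (xs ++ ys) ≡ linℚ g xs +ℚ linℚ g ys
linℚ-++ g []            ys = sym (ℚP.+-identityˡ _)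
linℚ-++ g ((c , a) ∷ xs) ys =
  trans (cong (c *ℚ g a +ℚ_) (linℚ-++ g xs ys)) (sym (ℚP.+-assoc (c *ℚ g a) (linℚ g xs) _))

linℚ-scale : ∀ (g : A → ℚ) c xs → linℚ g (scale c xs) ≡ c *ℚ linℚ g xs
linℚ-scale g c []            = sym (ℚP.*-zeroʳ c)
linℚ-scale g c ((d , a) ∷ xs) =
  trans (cong ((c *ℚ d) *ℚ g a +ℚ_) (linℚ-scale g c xs))
    (solve 4 (λ c d u r → (c :* d) :* u :+ c :* r := c :* (d :* u :+ r)) refl c d (g a) _)

linℚ-zero : ∀ x → linℚ (λ (_ : A) → 0ℚ) x ≡ 0ℚ
linℚ-zero []            = refl
linℚ-zero ((c , a) ∷ x) =
  trans (cong (c *ℚ 0ℚ +ℚ_) (linℚ-zero x)) (solve 1 (λ c → c :* con 0ℚ :+ con 0ℚ := con 0ℚ) refl c)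

linℚ-+ : ∀ (g h : A → ℚ) x → linℚ (λ a → g a +ℚ h a) x ≡ linℚ g x +ℚ linℚ h x
linℚ-+ g h []            = refl
linℚ-+ g h ((c , a) ∷ x) =
  trans (cong (c *ℚ (g a +ℚ h a) +ℚ_) (linℚ-+ g h x))
    (solve 5 (λ c u v r s → c :* (u :+ v) :+ (r :+ s) := (c :* u :+ r) :+ (c :* v :+ s))
           refl c (g a) (h a) _ _)

linℚ-*ˡ : ∀ (g : A → ℚ) c x → linℚ (λ a → c *ℚ g a) x ≡ c *ℚ linℚ g x
linℚ-*ˡ g c []            = sym (ℚP.*-zeroʳ c)
linℚ-*ˡ g c ((d , a) ∷ x) =
  trans (cong (d *ℚ (c *ℚ g a) +ℚ_) (linℚ-*ˡ g c x))
    (solve 4 (λ c d u r → d :* (c :* u) :+ c :* r := c :* (d :* u :+ r)) refl c d (g a) _)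

linℚ-*ʳ : ∀ (g : A → ℚ) c x → linℚ (λ a → g a *ℚ c) x ≡ linℚ g x *ℚ c
linℚ-*ʳ g c x = trans (linℚ-cong (λ a → ℚP.*-comm (g a) c) x) (trans (linℚ-*ˡ g c x) (ℚP.*-comm c _))

linℚ-lin : ∀ (g : B → ℚ) (f : A → FM B) x →
           linℚ g (lin f x) ≡ linℚ (λ a → linℚ g (f a)) x
linℚ-lin g f []            = refl
linℚ-lin g f ((c , a) ∷ x) =
  trans (linℚ-++ g (scale c (f a)) (lin f x)) (cong₂ _+ℚ_ (linℚ-scale g c (f a)) (linℚ-lin g f x))

linℚ-swap : ∀ (K : A → B → ℚ) x y →
            linℚ (λ a → linℚ (K a) y) x ≡ linℚ (λ b → linℚ (λ a → K a b) x) y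
linℚ-swap K []            y = sym (linℚ-zero y)
linℚ-swap K ((c , a) ∷ x) y =
  trans (cong₂ _+ℚ_ (sym (linℚ-*ˡ (K a) c y)) (linℚ-swap K x y))
        (sym (linℚ-+ (λ b → c *ℚ K a b) (λ b → linℚ (λ a → K a b) x) y))


module Combinations {E : Set} (_≟_ : DecidableEquality E) where

  coeff-++ : ∀ b (xs ys : FM E) → coeff _≟_ b (xs ++ ys) ≡ coeff _≟_ b xs +ℚ coeff _≟_ b ys
  coeff-++ b []            ys = sym (ℚP.+-identityˡ _)
  coeff-++ b ((c , a) ∷ xs) ys with b ≟ a
  ... | yes _ = trans (cong (c +ℚ_) (coeff-++ b xs ys)) (sym (ℚP.+-assoc c _ _))
  ... | no  _ = coeff-++ b xs ys

  coeff-scale : ∀ b c (xs : FM E) → coeff _≟_ b (scale c xs) ≡ c *ℚ coeff _≟_ b xs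
  coeff-scale b c []            = sym (ℚP.*-zeroʳ c)
  coeff-scale b c ((d , a) ∷ xs) with b ≟ a
  ... | yes _ = trans (cong (c *ℚ d +ℚ_) (coeff-scale b c xs)) (sym (ℚP.*-distribˡ-+ c d _))
  ... | no  _ = coeff-scale b c xs

  coeff-lin : ∀ (f : A → FM E) b x →
              coeff _≟_ b (lin f x) ≡ linℚ (λ a → coeff _≟_ b (f a)) x
  coeff-lin f b []            = refl
  coeff-lin f b ((c , a) ∷ x) =
    trans (coeff-++ b (scale c (f a)) (lin f x)) (cong₂ _+ℚ_ (coeff-scale b c (f a)) (coeff-lin f b x))

  coeff-terms : ∀ b x → coeff _≟_ b x ≡ linℚ (λ a → coeff _≟_ b (basis a)) x
  coeff-terms b []            = refl
  coeff-terms b ((c , a) ∷ x) with b ≟ a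
  ... | yes _ = cong₂ _+ℚ_ (solve 1 (λ c → c := c :* (con 1ℚ :+ con 0ℚ)) refl c) (coeff-terms b x)
  ... | no  _ = trans (coeff-terms b x) (solve 2 (λ c r → r := c :* con 0ℚ :+ r) refl c _)

  infix 4 _≋_
  record _≋_ (x y : FM E) : Set where
    constructor coeffwise
    field coeff-≡ : ∀ b → coeff _≟_ b x ≡ coeff _≟_ b y
  open _≋_ public

  ≋-refl : ∀ {x} → x ≋ x
  ≋-refl = coeffwise λ _ → refl

  ≋-sym : ∀ {x y} → x ≋ y → y ≋ x
  ≋-sym p = coeffwise λ b → sym (coeff-≡ p b)

  ≋-trans : ∀ {x y z} → x ≋ y → y ≋ z → x ≋ z
  ≋-trans p q = coeffwise λ b → trans (coeff-≡ p b) (coeff-≡ q b)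

  ≋-reflexive : ∀ {x y} → x ≡ y → x ≋ y
  ≋-reflexive refl = ≋-refl

  ≋-setoid : Setoid _ _
  ≋-setoid = record
    { Carrier = FM E ; _≈_ = _≋_
    ; isEquivalence = record { refl = ≋-refl ; sym = ≋-sym ; trans = ≋-trans } }

  module ≋-Reasoning = SetoidReasoning ≋-setoid

  -- Addition of combinations is concatenation.
  ≋-++ : ∀ {x x′ y y′} → x ≋ x′ → y ≋ y′ → (x ++ y) ≋ (x′ ++ y′)
  ≋-++ {x} {x′} {y} {y′} p q = coeffwise λ b →
    trans (coeff-++ b x y) (trans (cong₂ _+ℚ_ (coeff-≡ p b) (coeff-≡ q b)) (sym (coeff-++ b x′ y′)))

  ↭⇒≋ : ∀ {x y} → x ↭ y → x ≋ y
  ↭⇒≋ _↭_.refl         = ≋-refl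
  ↭⇒≋ (_↭_.prep t p)   = ≋-++ {t ∷ []} ≋-refl (↭⇒≋ p)
  ↭⇒≋ (_↭_.swap s t p) = ≋-trans (≋-++ {s ∷ t ∷ []} ≋-refl (↭⇒≋ p)) (swap-front _)
    where
      split-two : ∀ b s t z → coeff _≟_ b (s ∷ t ∷ z) ≡
                  coeff _≟_ b (s ∷ []) +ℚ (coeff _≟_ b (t ∷ []) +ℚ coeff _≟_ b z)
      split-two b s t z =
        trans (coeff-++ b (s ∷ []) (t ∷ z)) (cong (coeff _≟_ b (s ∷ []) +ℚ_) (coeff-++ b (t ∷ []) z))

      swap-front : ∀ z → (s ∷ t ∷ z) ≋ (t ∷ s ∷ z)
      swap-front z = coeffwise λ b → trans (split-two b s t z) (trans
        (solve 3 (λ u v w → u :+ (v :+ w) := v :+ (u :+ w)) refl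
          (coeff _≟_ b (s ∷ [])) (coeff _≟_ b (t ∷ [])) (coeff _≟_ b z))
        (sym (split-two b t s z)))
  ↭⇒≋ (_↭_.trans p q)  = ≋-trans (↭⇒≋ p) (↭⇒≋ q)

  coeff-single : ∀ b c a → coeff _≟_ b ((c , a) ∷ []) ≡ c *ℚ coeff _≟_ b (basis a)
  coeff-single b c a with b ≟ a
  ... | yes _ = solve 1 (λ c → c :+ con 0ℚ := c :* (con 1ℚ :+ con 0ℚ)) refl c
  ... | no  _ = sym (ℚP.*-zeroʳ c)

  drop-zero : ∀ e x → ((0ℚ , e) ∷ x) ≋ x
  drop-zero e x = coeffwise λ b → trans (coeff-++ b ((0ℚ , e) ∷ []) x)
    (trans (cong (_+ℚ coeff _≟_ b x) (trans (coeff-single b 0ℚ e) (ℚP.*-zeroˡ (coeff _≟_ b (basis e)))))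
           (ℚP.+-identityˡ _))

  zeros-vanish : ∀ (h : A → E) L → concatMap (λ a → (0ℚ , h a) ∷ []) L ≋ []
  zeros-vanish h []      = ≋-refl
  zeros-vanish h (a ∷ L) = ≋-trans (drop-zero (h a) _) (zeros-vanish h L)

  neg-cancel : ∀ x → (neg x ++ x) ≋ []
  neg-cancel x = coeffwise λ b → trans (coeff-++ b (neg x) x)
    (trans (cong (_+ℚ coeff _≟_ b x) (coeff-scale b (- 1ℚ) x))
      (solve 1 (λ c → con (- 1ℚ) :* c :+ c := con 0ℚ) refl (coeff _≟_ b x)))

  scale-one : ∀ x → scale 1ℚ x ≋ x
  scale-one x = coeffwise λ b → trans (coeff-scale b 1ℚ x) (ℚP.*-identityˡ _)

  concatMap-≋ : ∀ {f g : A → FM E} → (∀ a → f a ≋ g a) → ∀ L → concatMap f L ≋ concatMap g L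
  concatMap-≋ eq []      = ≋-refl
  concatMap-≋ eq (a ∷ L) = ≋-++ (eq a) (concatMap-≋ eq L)

  lin-cong : ∀ {f g : A → FM E} → (∀ a → f a ≋ g a) → ∀ x → lin f x ≋ lin g x
  lin-cong {f = f} {g} eq x = coeffwise λ b →
    trans (coeff-lin f b x) (trans (linℚ-cong (λ a → coeff-≡ (eq a) b) x) (sym (coeff-lin g b x)))

  lin-lin : ∀ (f : C → FM E) (g : A → FM C) x → lin f (lin g x) ≋ lin (λ a → lin f (g a)) x
  lin-lin f g x = coeffwise λ b → begin
      coeff _≟_ b (lin f (lin g x))                       ≡⟨ coeff-lin f b (lin g x) ⟩
      linℚ (λ c → coeff _≟_ b (f c)) (lin g x)            ≡⟨ linℚ-lin _ g x ⟩
      linℚ (λ a → linℚ (λ c → coeff _≟_ b (f c)) (g a)) x ≡⟨ linℚ-cong (λ a → coeff-lin f b (g a)) x ⟨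
      linℚ (λ a → coeff _≟_ b (lin f (g a))) x            ≡⟨ coeff-lin _ b x ⟨
      coeff _≟_ b (lin (λ a → lin f (g a)) x)             ∎
    where open ≡-Reasoning

  lin-swap : ∀ (K : A → C → FM E) x y →
             lin (λ a → lin (K a) y) x ≋ lin (λ c → lin (λ a → K a c) x) y
  lin-swap K x y = coeffwise λ b → begin
      coeff _≟_ b (lin (λ a → lin (K a) y) x)
        ≡⟨ trans (coeff-lin _ b x) (linℚ-cong (λ a → coeff-lin (K a) b y) x) ⟩
      linℚ (λ a → linℚ (λ c → coeff _≟_ b (K a c)) y) x
        ≡⟨ linℚ-swap (λ a c → coeff _≟_ b (K a c)) x y ⟩
      linℚ (λ c → linℚ (λ a → coeff _≟_ b (K a c)) x) y
        ≡⟨ trans (coeff-lin _ b y) (linℚ-cong (λ c → coeff-lin (λ a → K a c) b x) y) ⟨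
      coeff _≟_ b (lin (λ c → lin (λ a → K a c) x) y) ∎
    where open ≡-Reasoning

  lin-of-basis : ∀ (f : A → FM E) a → lin f (basis a) ≋ f a
  lin-of-basis f a = ≋-trans (≋-reflexive (LP.++-identityʳ _)) (scale-one (f a))

  lin-basis : ∀ x → lin basis x ≋ x
  lin-basis x = coeffwise λ b → trans (coeff-lin basis b x) (sym (coeff-terms b x))

  lin-retraction : ∀ (f : C → FM E) (g : E → FM C) → (∀ e → lin f (g e) ≋ basis e) →
                   ∀ x → lin f (lin g x) ≋ x
  lin-retraction f g inv x = ≋-trans (lin-lin f g x) (≋-trans (lin-cong inv x) (lin-basis x))

  lin-single : ∀ (g : A → ℚ) e x → lin (λ a → (g a , e) ∷ []) x ≋ (linℚ g x , e) ∷ []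
  lin-single g e x = coeffwise λ b → begin
      coeff _≟_ b (lin (λ a → (g a , e) ∷ []) x)          ≡⟨ coeff-lin (λ a → (g a , e) ∷ []) b x ⟩
      linℚ (λ a → coeff _≟_ b ((g a , e) ∷ [])) x         ≡⟨ linℚ-cong (λ a → coeff-single b (g a) e) x ⟩
      linℚ (λ a → g a *ℚ coeff _≟_ b (basis e)) x         ≡⟨ linℚ-*ʳ g _ x ⟩
      linℚ g x *ℚ coeff _≟_ b (basis e)                   ≡⟨ coeff-single b (linℚ g x) e ⟨
      coeff _≟_ b ((linℚ g x , e) ∷ [])                   ∎
    where open ≡-Reasoning

  lin-ones : ∀ (f : A → FM E) L → lin f (ones L) ≋ concatMap f L
  lin-ones f []      = ≋-refl
  lin-ones f (a ∷ L) = ≋-++ (scale-one (f a)) (lin-ones f L)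

  lin-ones-ones : ∀ {f : A → FM E} (g : A → List E) → (∀ a → f a ≋ ones (g a)) →
                  ∀ L → lin f (ones L) ≋ ones (concatMap g L)
  lin-ones-ones {f = f} g eq L =
    ≋-trans (lin-ones f L) (≋-trans (concatMap-≋ eq L) (≋-reflexive (sym (LP.map-concatMap (1ℚ ,_) g L))))

  bilin-cong : ∀ {f g : A → B → FM E} → (∀ a b → f a b ≋ g a b) → ∀ x y → bilin f x y ≋ bilin g x y
  bilin-cong eq x y = lin-cong (λ a → lin-cong (eq a) y) x

  lin-bilin : ∀ (g : C → FM E) (f : A → B → FM C) x y →
              lin g (bilin f x y) ≋ bilin (λ a b → lin g (f a b)) x y
  lin-bilin g f x y = ≋-trans (lin-lin g (λ a → lin (f a) y) x) (lin-cong (λ a → lin-lin g (f a) y) x)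

  bilin-lin : ∀ {A′ B′ : Set} (f : A′ → B′ → FM E) (g : A → FM A′) (h : B → FM B′) x y →
              bilin f (lin g x) (lin h y) ≋ bilin (λ a b → bilin f (g a) (h b)) x y
  bilin-lin f g h x y = begin
      lin (λ a′ → lin (f a′) (lin h y)) (lin g x)
        ≈⟨ lin-lin _ g x ⟩
      lin (λ a → lin (λ a′ → lin (f a′) (lin h y)) (g a)) x
        ≈⟨ lin-cong (λ a → lin-cong (λ a′ → lin-lin (f a′) h y) (g a)) x ⟩
      lin (λ a → lin (λ a′ → lin (λ b → lin (f a′) (h b)) y) (g a)) x
        ≈⟨ lin-cong (λ a → lin-swap (λ a′ b → lin (f a′) (h b)) (g a) y) x ⟩
      bilin (λ a b → bilin f (g a) (h b)) x y ∎
    where open ≋-Reasoning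

  bilin-ones : ∀ {f : A → B → FM E} (g : A → B → List E) → (∀ a b → f a b ≋ ones (g a b)) →
               ∀ X Y → bilin f (ones X) (ones Y) ≋ ones (concatMap (λ a → concatMap (g a) Y) X)
  bilin-ones g eq X Y = lin-ones-ones (λ a → concatMap (g a) Y) (λ a → lin-ones-ones (g a) (eq a) Y) X

concatMap-split : ∀ (f g : A → List B) xs →
                  concatMap (λ a → f a ++ g a) xs ↭ concatMap f xs ++ concatMap g xs
concatMap-split f g []       = ↭-refl
concatMap-split f g (a ∷ xs) = begin
    (f a ++ g a) ++ concatMap (λ a → f a ++ g a) xs   ↭⟨ ++⁺ˡ (f a ++ g a) (concatMap-split f g xs) ⟩
    (f a ++ g a) ++ (concatMap f xs ++ concatMap g xs) ≡⟨ LP.++-assoc (f a) (g a) _ ⟩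
    f a ++ (g a ++ (concatMap f xs ++ concatMap g xs)) ↭⟨ ++⁺ˡ (f a) (shifts (g a) (concatMap f xs)) ⟩
    f a ++ (concatMap f xs ++ (g a ++ concatMap g xs)) ≡⟨ LP.++-assoc (f a) (concatMap f xs) _ ⟨
    (f a ++ concatMap f xs) ++ (g a ++ concatMap g xs) ∎
  where open PermutationReasoning

concatMap-↭ : ∀ {f g : A → List B} → (∀ a → f a ↭ g a) → ∀ xs → concatMap f xs ↭ concatMap g xs
concatMap-↭ eq []       = ↭-refl
concatMap-↭ eq (a ∷ xs) = ++⁺ (eq a) (concatMap-↭ eq xs)

interchange : ∀ (a b c d : List A) → (a ++ b) ++ (c ++ d) ↭ (a ++ c) ++ (b ++ d)
interchange a b c d = begin
    (a ++ b) ++ (c ++ d) ≡⟨ LP.++-assoc a b _ ⟩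
    a ++ (b ++ (c ++ d)) ↭⟨ ++⁺ˡ a (shifts b c) ⟩
    a ++ (c ++ (b ++ d)) ≡⟨ LP.++-assoc a c _ ⟨
    (a ++ c) ++ (b ++ d) ∎
  where open PermutationReasoning

concatMap-singleton : ∀ (f : A → B) xs → concatMap (λ a → f a ∷ []) xs ≡ map f xs
concatMap-singleton f xs = trans (sym (LP.concatMap-map [_] f xs)) (LP.concatMap-pure (map f xs))

shuffles-[]ʳ : ∀ (x : List A) → shuffles x [] ≡ x ∷ []
shuffles-[]ʳ []      = refl
shuffles-[]ʳ (a ∷ x) = refl

concatMap-shuffles : ∀ (f : List A → List B) a x b y →
  concatMap f (shuffles (a ∷ x) (b ∷ y)) ≡
  concatMap (f ∘ (a ∷_)) (shuffles x (b ∷ y)) ++ concatMap (f ∘ (b ∷_)) (shuffles (a ∷ x) y)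
concatMap-shuffles f a x b y =
  trans (LP.concatMap-++ f (map (a ∷_) (shuffles x (b ∷ y))) (map (b ∷_) (shuffles (a ∷ x) y)))
        (cong₂ _++_ (LP.concatMap-map f (a ∷_) (shuffles x (b ∷ y))) (LP.concatMap-map f (b ∷_) (shuffles (a ∷ x) y)))

shuffle₃ˡ shuffle₃ʳ : List A → List A → List A → List (List A)
shuffle₃ˡ x y z = concatMap (λ w → shuffles w z) (shuffles x y)
shuffle₃ʳ x y z = concatMap (shuffles x) (shuffles y z)

byFirstLetter : (List A → List A → List A → List (List A)) →
                A → List A → A → List A → A → List A → List (List A)
byFirstLetter F a x b y c z =
  map (a ∷_) (F x (b ∷ y) (c ∷ z)) ++ map (b ∷_) (F (a ∷ x) y (c ∷ z)) ++ map (c ∷_) (F (a ∷ x) (b ∷ y) z)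

shuffle₃ˡ-byFirstLetter : ∀ (a : A) x b y c z →
  shuffle₃ˡ (a ∷ x) (b ∷ y) (c ∷ z) ↭ byFirstLetter shuffle₃ˡ a x b y c z
shuffle₃ˡ-byFirstLetter a x b y c z = begin
    shuffle₃ˡ (a ∷ x) (b ∷ y) (c ∷ z)
      ≡⟨ concatMap-shuffles (λ w → shuffles w (c ∷ z)) a x b y ⟩
    concatMap (λ w → map (a ∷_) (shuffles w (c ∷ z)) ++ map (c ∷_) (shuffles (a ∷ w) z)) S₁
      ++ concatMap (λ w → map (b ∷_) (shuffles w (c ∷ z)) ++ map (c ∷_) (shuffles (b ∷ w) z)) S₂
      ↭⟨ ++⁺ (concatMap-split _ _ S₁) (concatMap-split _ _ S₂) ⟩
    (A₁ ++ C₁) ++ (B₁ ++ C₂)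
      ↭⟨ interchange A₁ C₁ B₁ C₂ ⟩
    (A₁ ++ B₁) ++ (C₁ ++ C₂)
      ≡⟨ LP.++-assoc A₁ B₁ _ ⟩
    A₁ ++ B₁ ++ C₁ ++ C₂
      ≡⟨ cong₂ _++_ (sym (LP.map-concatMap (a ∷_) _ S₁)) (cong₂ _++_ (sym (LP.map-concatMap (b ∷_) _ S₂))
           (trans (cong₂ _++_ (sym (LP.map-concatMap (c ∷_) _ S₁)) (sym (LP.map-concatMap (c ∷_) _ S₂)))
             (trans (sym (LP.map-++ (c ∷_) (concatMap (λ w → shuffles (a ∷ w) z) S₁)
                                         (concatMap (λ w → shuffles (b ∷ w) z) S₂)))
               (cong (map (c ∷_)) (sym (concatMap-shuffles (λ w → shuffles w z) a x b y)))))) ⟩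
    byFirstLetter shuffle₃ˡ a x b y c z ∎
  where
    open PermutationReasoning
    S₁ = shuffles x (b ∷ y)
    S₂ = shuffles (a ∷ x) y
    A₁ = concatMap (λ w → map (a ∷_) (shuffles w (c ∷ z))) S₁
    B₁ = concatMap (λ w → map (b ∷_) (shuffles w (c ∷ z))) S₂
    C₁ = concatMap (λ w → map (c ∷_) (shuffles (a ∷ w) z)) S₁
    C₂ = concatMap (λ w → map (c ∷_) (shuffles (b ∷ w) z)) S₂

shuffle₃ʳ-byFirstLetter : ∀ (a : A) x b y c z →
  shuffle₃ʳ (a ∷ x) (b ∷ y) (c ∷ z) ↭ byFirstLetter shuffle₃ʳ a x b y c z
shuffle₃ʳ-byFirstLetter a x b y c z = begin
    shuffle₃ʳ (a ∷ x) (b ∷ y) (c ∷ z)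
      ≡⟨ concatMap-shuffles (shuffles (a ∷ x)) b y c z ⟩
    concatMap (λ t → map (a ∷_) (shuffles x (b ∷ t)) ++ map (b ∷_) (shuffles (a ∷ x) t)) T₁
      ++ concatMap (λ t → map (a ∷_) (shuffles x (c ∷ t)) ++ map (c ∷_) (shuffles (a ∷ x) t)) T₂
      ↭⟨ ++⁺ (concatMap-split _ _ T₁) (concatMap-split _ _ T₂) ⟩
    (A₁ ++ B₁) ++ (A₂ ++ C₂)
      ↭⟨ interchange A₁ B₁ A₂ C₂ ⟩
    (A₁ ++ A₂) ++ (B₁ ++ C₂)
      ≡⟨ cong₂ _++_
           (trans (cong₂ _++_ (sym (LP.map-concatMap (a ∷_) _ T₁)) (sym (LP.map-concatMap (a ∷_) _ T₂)))
             (trans (sym (LP.map-++ (a ∷_) (concatMap (λ t → shuffles x (b ∷ t)) T₁)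
                                         (concatMap (λ t → shuffles x (c ∷ t)) T₂)))
               (cong (map (a ∷_)) (sym (concatMap-shuffles (shuffles x) b y c z)))))
           (cong₂ _++_ (sym (LP.map-concatMap (b ∷_) _ T₁)) (sym (LP.map-concatMap (c ∷_) _ T₂))) ⟩
    byFirstLetter shuffle₃ʳ a x b y c z ∎
  where
    open PermutationReasoning
    T₁ = shuffles y (c ∷ z)
    T₂ = shuffles (b ∷ y) z
    A₁ = concatMap (λ t → map (a ∷_) (shuffles x (b ∷ t))) T₁
    B₁ = concatMap (λ t → map (b ∷_) (shuffles (a ∷ x) t)) T₁
    A₂ = concatMap (λ t → map (a ∷_) (shuffles x (c ∷ t))) T₂
    C₂ = concatMap (λ t → map (c ∷_) (shuffles (a ∷ x) t)) T₂

shuffle-assoc : ∀ (x y z : List A) → shuffle₃ˡ x y z ↭ shuffle₃ʳ x y z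
shuffle-assoc []      y       z       =
  ↭-reflexive (trans (LP.++-identityʳ _) (sym (LP.concatMap-pure _)))
shuffle-assoc (a ∷ x) []      z       = ↭-refl
shuffle-assoc (a ∷ x) (b ∷ y) []      = ↭-reflexive (begin
    concatMap (λ w → shuffles w []) S ≡⟨ LP.concatMap-cong shuffles-[]ʳ S ⟩
    concatMap [_] S                   ≡⟨ LP.concatMap-pure S ⟩
    S                                 ≡⟨ LP.++-identityʳ S ⟨
    S ++ []                           ∎)
  where
    open ≡-Reasoning
    S = shuffles (a ∷ x) (b ∷ y)
shuffle-assoc (a ∷ x) (b ∷ y) (c ∷ z) = begin
    shuffle₃ˡ (a ∷ x) (b ∷ y) (c ∷ z)   ↭⟨ shuffle₃ˡ-byFirstLetter a x b y c z ⟩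
    byFirstLetter shuffle₃ˡ a x b y c z
      ↭⟨ ++⁺ (map⁺ (a ∷_) (shuffle-assoc x (b ∷ y) (c ∷ z)))
           (++⁺ (map⁺ (b ∷_) (shuffle-assoc (a ∷ x) y (c ∷ z))) (map⁺ (c ∷_) (shuffle-assoc (a ∷ x) (b ∷ y) z))) ⟩
    byFirstLetter shuffle₃ʳ a x b y c z ↭⟨ shuffle₃ʳ-byFirstLetter a x b y c z ⟨
    shuffle₃ʳ (a ∷ x) (b ∷ y) (c ∷ z)   ∎
  where open PermutationReasoning

shuffles-map : ∀ (f : A → B) x y → map (map f) (shuffles x y) ≡ shuffles (map f x) (map f y)
shuffles-map f []      y       = refl
shuffles-map f (a ∷ x) []      = refl
shuffles-map f (a ∷ x) (b ∷ y) = trans (LP.map-++ (map f) (map (a ∷_) S₁) (map (b ∷_) S₂))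
  (cong₂ _++_ (trans (sym (LP.map-∘ S₁)) (trans (LP.map-∘ S₁) (cong (map (f a ∷_)) (shuffles-map f x (b ∷ y)))))
              (trans (sym (LP.map-∘ S₂)) (trans (LP.map-∘ S₂) (cong (map (f b ∷_)) (shuffles-map f (a ∷ x) y)))))
  where
    S₁ = shuffles x (b ∷ y)
    S₂ = shuffles (a ∷ x) y

shuffles-length : ∀ (x y : List A) → All (λ w → length w ≡ length x + length y) (shuffles x y)
shuffles-length []      y       = refl ∷ []
shuffles-length (a ∷ x) []      = cong suc (sym (ℕP.+-identityʳ (length x))) ∷ []
shuffles-length (a ∷ x) (b ∷ y) = AllP.++⁺
  (AllP.map⁺ (All.map (cong suc) (shuffles-length x (b ∷ y))))
  (AllP.map⁺ (All.map (λ e → trans (cong suc e) (sym (ℕP.+-suc (suc (length x)) (length y))))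
                      (shuffles-length (a ∷ x) y)))

push : A → List A × B → List A × B
push a s = (a ∷ proj₁ s , proj₂ s)

splits : List A → List (List A × List A)
splits []      = ([] , []) ∷ []
splits (a ∷ w) = ([] , a ∷ w) ∷ map (push a) (splits w)

splits-map : ∀ (f : A → B) u →
             splits (map f u) ≡ map (λ s → (map f (proj₁ s) , map f (proj₂ s))) (splits u)
splits-map f []      = refl
splits-map f (a ∷ w) = cong (([] , f a ∷ map f w) ∷_)
  (trans (cong (map (push (f a))) (splits-map f w)) (trans (sym (LP.map-∘ (splits w))) (LP.map-∘ (splits w))))

splits-length : ∀ (u : List A) → All (λ s → length (proj₁ s) + length (proj₂ s) ≡ length u) (splits u)
splits-length []      = refl ∷ []
splits-length (a ∷ w) = refl ∷ AllP.map⁺ (All.map (cong suc) (splits-length w))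

splits-prefixed : ∀ (F : List A → List A → List B) p x w →
  concatMap (λ s → F (p ++ proj₁ s) (proj₂ s)) (splits (x ∷ w)) ≡
  F p (x ∷ w) ++ concatMap (λ s → F ((p ++ x ∷ []) ++ proj₁ s) (proj₂ s)) (splits w)
splits-prefixed F p x w = cong₂ _++_ (cong (λ q → F q (x ∷ w)) (LP.++-identityʳ p))
  (trans (LP.concatMap-map _ (push x) (splits w))
         (LP.concatMap-cong (λ s → cong (λ q → F q (proj₂ s)) (sym (LP.++-assoc p (x ∷ []) (proj₁ s)))) (splits w)))

cutsLeft cutsRight : List A → List (List A × List A × List A)
cutsLeft  u = concatMap (λ s → map (λ t → (proj₁ t , proj₂ t , proj₂ s)) (splits (proj₁ s))) (splits u)
cutsRight u = concatMap (λ s → map (λ t → (proj₁ s , proj₁ t , proj₂ t)) (splits (proj₂ s))) (splits u)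

splits-coassoc : ∀ {A : Set} (u : List A) → cutsLeft u ↭ cutsRight u
splits-coassoc []      = ↭-refl
splits-coassoc {A} (x ∷ w) = begin
    cutsLeft (x ∷ w)
      ≡⟨ cong (([] , [] , x ∷ w) ∷_) (trans (LP.concatMap-map left (push x) (splits w))
           (LP.concatMap-cong (λ s → cong (([] , x ∷ proj₁ s , proj₂ s) ∷_)
             (trans (sym (LP.map-∘ (splits (proj₁ s)))) (LP.map-∘ (splits (proj₁ s))))) (splits w))) ⟩
    ([] , [] , x ∷ w) ∷ concatMap (λ s → (([] , x ∷ proj₁ s , proj₂ s) ∷ []) ++ map push₃ (left s)) (splits w)
      ↭⟨ ++⁺ˡ (([] , [] , x ∷ w) ∷ []) (concatMap-split _ (map push₃ ∘ left) (splits w)) ⟩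
    ([] , [] , x ∷ w) ∷ (concatMap (λ s → ([] , x ∷ proj₁ s , proj₂ s) ∷ []) (splits w)
                         ++ concatMap (map push₃ ∘ left) (splits w))
      ≡⟨ cong (([] , [] , x ∷ w) ∷_) (cong₂ _++_ (concatMap-singleton _ (splits w))
                                               (sym (LP.map-concatMap push₃ left (splits w)))) ⟩
    ([] , [] , x ∷ w) ∷ (middle ++ map push₃ (cutsLeft w))
      ↭⟨ ++⁺ˡ (([] , [] , x ∷ w) ∷ middle) (map⁺ push₃ (splits-coassoc w)) ⟩
    ([] , [] , x ∷ w) ∷ (middle ++ map push₃ (cutsRight w))
      ≡⟨ cong (([] , [] , x ∷ w) ∷_) (cong₂ _++_ (LP.map-∘ (splits w))
           (trans (LP.map-concatMap push₃ right (splits w))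
             (trans (LP.concatMap-cong (λ s → sym (LP.map-∘ (splits (proj₂ s)))) (splits w))
               (sym (LP.concatMap-map right (push x) (splits w)))))) ⟩
    cutsRight (x ∷ w) ∎
  where
    open PermutationReasoning
    push₃ : List A × List A × List A → List A × List A × List A
    push₃ = push x
    left right : List A × List A → List (List A × List A × List A)
    left  s = map (λ t → (proj₁ t , proj₂ t , proj₂ s)) (splits (proj₁ s))
    right s = map (λ t → (proj₁ s , proj₁ t , proj₂ t)) (splits (proj₂ s))
    middle : List (List A × List A × List A)
    middle = map (λ s → ([] , x ∷ proj₁ s , proj₂ s)) (splits w)

cartesianProduct-push : ∀ (a : A) (X : List (List A)) (Y : List B) →
  cartesianProduct (map (a ∷_) X) Y ≡ map (push a) (cartesianProduct X Y)
cartesianProduct-push a []      Y = refl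
cartesianProduct-push a (x ∷ X) Y =
  trans (cong₂ _++_ (LP.map-∘ {g = push a} {f = x ,_} Y) (cartesianProduct-push a X Y))
        (sym (LP.map-++ (push a) (map (x ,_) Y) (cartesianProduct X Y)))

shufflePairs : List A × List A → List A × List A → List (List A × List A)
shufflePairs p q = cartesianProduct (shuffles (proj₁ p) (proj₁ q)) (shuffles (proj₂ p) (proj₂ q))

shufflePairsWithSplits : List A → List A × List A → List (List A × List A)
shufflePairsWithSplits y p = concatMap (shufflePairs p) (splits y)

splitThenShuffle : List A → List A → List (List A × List A)
splitThenShuffle x y = concatMap (shufflePairsWithSplits y) (splits x)

-- Both sides satisfy this recurrence in x and y: the pairs with empty
-- first piece, then those whose first piece starts with a, then with b.
byFirstPiece : (List A → List A → List (List A × List A)) →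
               A → List A → A → List A → List (List A × List A)
byFirstPiece F a x b y =
  map ([] ,_) (shuffles (a ∷ x) (b ∷ y)) ++ map (push a) (F x (b ∷ y)) ++ map (push b) (F (a ∷ x) y)

splitsOfShuffles-byFirstPiece : ∀ (a : A) x b y →
  concatMap splits (shuffles (a ∷ x) (b ∷ y)) ↭ byFirstPiece (λ x y → concatMap splits (shuffles x y)) a x b y
splitsOfShuffles-byFirstPiece a x b y = begin
    concatMap splits (shuffles (a ∷ x) (b ∷ y))
      ≡⟨ concatMap-shuffles splits a x b y ⟩
    concatMap (λ w → (([] , a ∷ w) ∷ []) ++ map (push a) (splits w)) S₁
      ++ concatMap (λ w → (([] , b ∷ w) ∷ []) ++ map (push b) (splits w)) S₂
      ↭⟨ ++⁺ (concatMap-split _ _ S₁) (concatMap-split _ _ S₂) ⟩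
    (K₁ ++ M₁) ++ (K₂ ++ M₂)
      ↭⟨ interchange K₁ M₁ K₂ M₂ ⟩
    (K₁ ++ K₂) ++ (M₁ ++ M₂)
      ≡⟨ cong₂ _++_
           (trans (cong₂ _++_ (trans (concatMap-singleton _ S₁) (LP.map-∘ S₁))
                              (trans (concatMap-singleton _ S₂) (LP.map-∘ S₂)))
                  (sym (LP.map-++ ([] ,_) (map (a ∷_) S₁) (map (b ∷_) S₂))))
           (sym (cong₂ _++_ (LP.map-concatMap (push a) splits S₁) (LP.map-concatMap (push b) splits S₂))) ⟩
    byFirstPiece (λ x y → concatMap splits (shuffles x y)) a x b y ∎
  where
    open PermutationReasoning
    S₁ = shuffles x (b ∷ y)
    S₂ = shuffles (a ∷ x) y
    K₁ = concatMap (λ w → ([] , a ∷ w) ∷ []) S₁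
    K₂ = concatMap (λ w → ([] , b ∷ w) ∷ []) S₂
    M₁ = concatMap (λ w → map (push a) (splits w)) S₁
    M₂ = concatMap (λ w → map (push b) (splits w)) S₂

shufflePairs-[]-push : ∀ (x : List A) b q →
  shufflePairs ([] , x) (push b q) ≡ map (push b) (shufflePairs ([] , x) q)
shufflePairs-[]-push x b q = cartesianProduct-push b (proj₁ q ∷ []) _

shufflePairs-push-[] : ∀ (a : A) p y →
  shufflePairs (push a p) ([] , y) ≡ map (push a) (shufflePairs p ([] , y))
shufflePairs-push-[] a p y = trans (cartesianProduct-push a (proj₁ p ∷ []) _)
  (cong (λ S → map (push a) (cartesianProduct S (shuffles (proj₂ p) y))) (sym (shuffles-[]ʳ (proj₁ p))))

shufflePairs-push-push : ∀ (a : A) p b q →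
  shufflePairs (push a p) (push b q) ≡
  map (push a) (shufflePairs p (push b q)) ++ map (push b) (shufflePairs (push a p) q)
shufflePairs-push-push a p b q =
  trans (LP.cartesianProductWith-distribʳ-++ _,_ (map (a ∷_) S₁) (map (b ∷_) S₂) T)
        (cong₂ _++_ (cartesianProduct-push a S₁ T) (cartesianProduct-push b S₂ T))
  where
    S₁ = shuffles (proj₁ p) (b ∷ proj₁ q)
    S₂ = shuffles (a ∷ proj₁ p) (proj₁ q)
    T  = shuffles (proj₂ p) (proj₂ q)

shufflePairsWithSplits-[] : ∀ b y (x : List A) →
  shufflePairsWithSplits (b ∷ y) ([] , x) ≡
  map ([] ,_) (shuffles x (b ∷ y)) ++ map (push b) (shufflePairsWithSplits y ([] , x))
shufflePairsWithSplits-[] b y x = cong₂ _++_ (LP.++-identityʳ _) (begin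
    concatMap (shufflePairs ([] , x)) (map (push b) (splits y))
      ≡⟨ LP.concatMap-map _ (push b) (splits y) ⟩
    concatMap (λ q → shufflePairs ([] , x) (push b q)) (splits y)
      ≡⟨ LP.concatMap-cong (shufflePairs-[]-push x b) (splits y) ⟩
    concatMap (λ q → map (push b) (shufflePairs ([] , x) q)) (splits y)
      ≡⟨ LP.map-concatMap (push b) (shufflePairs ([] , x)) (splits y) ⟨
    map (push b) (shufflePairsWithSplits y ([] , x)) ∎)
  where open ≡-Reasoning

shufflePairsWithSplits-push : ∀ (a : A) b y p →
  shufflePairsWithSplits (b ∷ y) (push a p) ↭
  map (push a) (shufflePairsWithSplits (b ∷ y) p) ++ map (push b) (shufflePairsWithSplits y (push a p))
shufflePairsWithSplits-push a b y p = begin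
    shufflePairs (push a p) ([] , b ∷ y) ++ concatMap (shufflePairs (push a p)) (map (push b) (splits y))
      ≡⟨ cong₂ _++_ (shufflePairs-push-[] a p (b ∷ y))
           (trans (LP.concatMap-map _ (push b) (splits y))
                  (LP.concatMap-cong (shufflePairs-push-push a p b) (splits y))) ⟩
    X₀ ++ concatMap (λ q → map (push a) (shufflePairs p (push b q)) ++ map (push b) (shufflePairs (push a p) q)) (splits y)
      ↭⟨ ++⁺ˡ X₀ (concatMap-split _ _ (splits y)) ⟩
    X₀ ++ (X₁ ++ X₂)
      ≡⟨ LP.++-assoc X₀ X₁ X₂ ⟨
    (X₀ ++ X₁) ++ X₂
      ≡⟨ cong₂ _++_
           (sym (trans (LP.map-++ (push a) (shufflePairs p ([] , b ∷ y)) (concatMap (shufflePairs p) Y))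
                  (cong (X₀ ++_) (trans (LP.map-concatMap (push a) (shufflePairs p) Y)
                                        (LP.concatMap-map _ (push b) (splits y))))))
           (sym (LP.map-concatMap (push b) (shufflePairs (push a p)) (splits y))) ⟩
    map (push a) (shufflePairsWithSplits (b ∷ y) p) ++ map (push b) (shufflePairsWithSplits y (push a p)) ∎
  where
    open PermutationReasoning
    Y  = map (push b) (splits y)
    X₀ = map (push a) (shufflePairs p ([] , b ∷ y))
    X₁ = concatMap (λ q → map (push a) (shufflePairs p (push b q))) (splits y)
    X₂ = concatMap (λ q → map (push b) (shufflePairs (push a p) q)) (splits y)

splitThenShuffle-byFirstPiece : ∀ (a : A) x b y →
  splitThenShuffle (a ∷ x) (b ∷ y) ↭ byFirstPiece splitThenShuffle a x b y
splitThenShuffle-byFirstPiece a x b y = begin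
    splitThenShuffle (a ∷ x) (b ∷ y)
      ≡⟨ cong₂ _++_ (shufflePairsWithSplits-[] b y (a ∷ x)) (LP.concatMap-map _ (push a) (splits x)) ⟩
    (M₀ ++ B₀) ++ concatMap (λ p → shufflePairsWithSplits (b ∷ y) (push a p)) (splits x)
      ↭⟨ ++⁺ˡ (M₀ ++ B₀) (concatMap-↭ (shufflePairsWithSplits-push a b y) (splits x)) ⟩
    (M₀ ++ B₀) ++ concatMap (λ p → map (push a) (shufflePairsWithSplits (b ∷ y) p)
                                   ++ map (push b) (shufflePairsWithSplits y (push a p))) (splits x)
      ↭⟨ ++⁺ˡ (M₀ ++ B₀) (concatMap-split _ _ (splits x)) ⟩
    (M₀ ++ B₀) ++ (A′ ++ B′)
      ≡⟨ LP.++-assoc M₀ B₀ _ ⟩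
    M₀ ++ B₀ ++ A′ ++ B′
      ↭⟨ ++⁺ˡ M₀ (shifts B₀ A′) ⟩
    M₀ ++ A′ ++ B₀ ++ B′
      ≡⟨ cong (M₀ ++_) (cong₂ _++_ (sym (LP.map-concatMap (push a) (shufflePairsWithSplits (b ∷ y)) (splits x)))
           (trans (cong (B₀ ++_) (trans (sym (LP.map-concatMap (push b) _ (splits x)))
                                        (cong (map (push b)) (sym (LP.concatMap-map _ (push a) (splits x))))))
                  (sym (LP.map-++ (push b) (shufflePairsWithSplits y ([] , a ∷ x)) _)))) ⟩
    byFirstPiece splitThenShuffle a x b y ∎
  where
    open PermutationReasoning
    M₀ = map ([] ,_) (shuffles (a ∷ x) (b ∷ y))
    B₀ = map (push b) (shufflePairsWithSplits y ([] , a ∷ x))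
    A′ = concatMap (λ p → map (push a) (shufflePairsWithSplits (b ∷ y) p)) (splits x)
    B′ = concatMap (λ p → map (push b) (shufflePairsWithSplits y (push a p))) (splits x)

splits-shuffles : ∀ (x y : List A) → concatMap splits (shuffles x y) ↭ splitThenShuffle x y
splits-shuffles []      y       = ↭-reflexive (cong (_++ []) (sym (LP.concatMap-pure (splits y))))
splits-shuffles (a ∷ x) []      = ↭-reflexive (sym (begin
    concatMap (λ p → shufflePairs p ([] , []) ++ []) (splits (a ∷ x))
      ≡⟨ LP.concatMap-cong (λ p → cong₂ (λ S T → cartesianProduct S T ++ [])
                                         (shuffles-[]ʳ (proj₁ p)) (shuffles-[]ʳ (proj₂ p))) (splits (a ∷ x)) ⟩
    concatMap [_] (splits (a ∷ x))
      ≡⟨ LP.concatMap-pure (splits (a ∷ x)) ⟩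
    splits (a ∷ x)
      ≡⟨ LP.++-identityʳ (splits (a ∷ x)) ⟨
    splits (a ∷ x) ++ [] ∎))
  where open ≡-Reasoning
splits-shuffles (a ∷ x) (b ∷ y) = begin
    concatMap splits (shuffles (a ∷ x) (b ∷ y))
      ↭⟨ splitsOfShuffles-byFirstPiece a x b y ⟩
    byFirstPiece (λ x y → concatMap splits (shuffles x y)) a x b y
      ↭⟨ ++⁺ˡ (map ([] ,_) (shuffles (a ∷ x) (b ∷ y)))
           (++⁺ (map⁺ (push a) (splits-shuffles x (b ∷ y))) (map⁺ (push b) (splits-shuffles (a ∷ x) y))) ⟩
    byFirstPiece splitThenShuffle a x b y
      ↭⟨ splitThenShuffle-byFirstPiece a x b y ⟨
    splitThenShuffle (a ∷ x) (b ∷ y) ∎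
  where open PermutationReasoning

open Combinations _≟Basis_ using () renaming (_≋_ to _≋₁_)
open Combinations _≟₂_     using () renaming (_≋_ to _≋₂_)
open Combinations _≟₃_     using () renaming (_≋_ to _≋₃_)

nullFace : Basis → Basis
nullFace = map (λ _ → true)

nullFace-idem : ∀ u → nullFace (nullFace u) ≡ nullFace u
nullFace-idem u = sym (LP.map-∘ u)

replicate-nullFace : ∀ u → replicate (length u) true ≡ nullFace u
replicate-nullFace []      = refl
replicate-nullFace (x ∷ u) = cong (true ∷_) (replicate-nullFace u)

mulB-shuffles : ∀ u v → mulB u v ≡ ones (shuffles (nullFace u) v)
mulB-shuffles []      v       = refl
mulB-shuffles (x ∷ u) []      = cong (λ w → (1ℚ , true ∷ w) ∷ []) (replicate-nullFace u)
mulB-shuffles (x ∷ u) (y ∷ v) = cong (λ w → ones (shuffles (true ∷ w) (y ∷ v))) (replicate-nullFace u)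

ΔB-splits : ∀ u → ΔB u ≡ ones (splits u)
ΔB-splits u = trans (LP.map-applyUpTo (λ i → i) _ (suc (length u)))
  (trans (sym (LP.map-applyUpTo (λ i → (take i u , drop i u)) (1ℚ ,_) (suc (length u))))
         (cong ones (splitsAt u)))
  where
    splitsAt : ∀ (u : Basis) → applyUpTo (λ i → (take i u , drop i u)) (suc (length u)) ≡ splits u
    splitsAt []      = refl
    splitsAt (a ∷ w) = cong (([] , a ∷ w) ∷_)
      (trans (sym (LP.map-applyUpTo (λ i → (take i w , drop i w)) (push a) (suc (length w))))
             (cong (map (push a)) (splitsAt w)))

lin-ΔB : ∀ (f : Basis × Basis → V) u → lin f (ΔB u) ≋₁ concatMap f (splits u)
lin-ΔB f u = ≋-trans (≋-reflexive (cong (lin f) (ΔB-splits u))) (lin-ones f (splits u))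
  where open Combinations _≟Basis_

mulB-graded : ∀ u v → All (λ t → deg (proj₂ t) ≡ deg u + deg v) (mulB u v)
mulB-graded u v = subst (All (λ t → deg (proj₂ t) ≡ deg u + deg v)) (sym (mulB-shuffles u v))
  (AllP.map⁺ (All.map (λ e → trans e (cong (_+ length v) (LP.length-map _ u)))
                      (shuffles-length (nullFace u) v)))

ΔB-graded : ∀ u → All (λ t → deg (proj₁ (proj₂ t)) + deg (proj₂ (proj₂ t)) ≡ deg u) (ΔB u)
ΔB-graded u = subst (All _) (sym (ΔB-splits u)) (AllP.map⁺ (splits-length u))

-- The left factor of a product only matters through its degree, so
-- (F_u · F_v) · F_w only involves ∅_{deg u} ⧢ ∅_{deg v} ⧢ w.
nullFace-absorbs : ∀ u v w →
  concatMap (λ p → shuffles (nullFace p) w) (shuffles (nullFace u) v) ≡ shuffle₃ˡ (nullFace u) (nullFace v) w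
nullFace-absorbs u v w = begin
    concatMap (λ p → shuffles (nullFace p) w) (shuffles (nullFace u) v)
      ≡⟨ LP.concatMap-map (λ p → shuffles p w) nullFace (shuffles (nullFace u) v) ⟨
    concatMap (λ p → shuffles p w) (map nullFace (shuffles (nullFace u) v))
      ≡⟨ cong (concatMap (λ p → shuffles p w)) (shuffles-map _ (nullFace u) v) ⟩
    shuffle₃ˡ (nullFace (nullFace u)) (nullFace v) w
      ≡⟨ cong (λ x → shuffle₃ˡ x (nullFace v) w) (nullFace-idem u) ⟩
    shuffle₃ˡ (nullFace u) (nullFace v) w ∎
  where open ≡-Reasoning

-- On basis elements associativity is associativity of the shuffle product.
mulB-assoc : ∀ u v w → lin (λ p → mulB p w) (mulB u v) ≋₁ lin (mulB u) (mulB v w)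
mulB-assoc u v w = begin
    lin (λ p → mulB p w) (mulB u v)
      ≡⟨ cong (lin _) (mulB-shuffles u v) ⟩
    lin (λ p → mulB p w) (ones (shuffles (nullFace u) v))
      ≈⟨ lin-ones-ones (λ p → shuffles (nullFace p) w) (λ p → ≋-reflexive (mulB-shuffles p w)) (shuffles (nullFace u) v) ⟩
    ones (concatMap (λ p → shuffles (nullFace p) w) (shuffles (nullFace u) v))
      ≡⟨ cong ones (nullFace-absorbs u v w) ⟩
    ones (shuffle₃ˡ (nullFace u) (nullFace v) w)
      ≈⟨ ↭⇒≋ (map⁺ (1ℚ ,_) (shuffle-assoc (nullFace u) (nullFace v) w)) ⟩
    ones (shuffle₃ʳ (nullFace u) (nullFace v) w)
      ≈⟨ lin-ones-ones (shuffles (nullFace u)) (λ t → ≋-reflexive (mulB-shuffles u t)) (shuffles (nullFace v) w) ⟨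
    lin (mulB u) (ones (shuffles (nullFace v) w))
      ≡⟨ cong (lin (mulB u)) (mulB-shuffles v w) ⟨
    lin (mulB u) (mulB v w) ∎
  where
    open Combinations _≟Basis_
    open ≋-Reasoning

·-assoc : ∀ x y z → ((x · y) · z) ≈ (x · (y · z))
·-assoc x y z = coeff-≡ (begin
    (x · y) · z
      ≈⟨ lin-bilin (λ p → lin (mulB p) z) mulB x y ⟩
    bilin (λ u v → lin (λ p → lin (mulB p) z) (mulB u v)) x y
      ≈⟨ bilin-cong (λ u v → lin-swap (λ p w → mulB p w) (mulB u v) z) x y ⟩
    bilin (λ u v → lin (λ w → lin (λ p → mulB p w) (mulB u v)) z) x y
      ≈⟨ bilin-cong (λ u v → lin-cong (mulB-assoc u v) z) x y ⟩
    lin (λ u → bilin (λ v w → lin (mulB u) (mulB v w)) y z) x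
      ≈⟨ lin-cong (λ u → lin-bilin (mulB u) mulB y z) x ⟨
    x · (y · z) ∎)
  where
    open Combinations _≟Basis_
    open ≋-Reasoning

one-· : ∀ x → (one · x) ≈ x
one-· x = coeff-≡ (≋-trans (lin-of-basis (λ a → lin (mulB a) x) []) (lin-basis x))
  where open Combinations _≟Basis_

Δ⊗idB id⊗ΔB : Basis × Basis → V₃
Δ⊗idB s = map (λ t → (proj₁ t , proj₁ (proj₂ t) , proj₂ (proj₂ t) , proj₂ s)) (ΔB (proj₁ s))
id⊗ΔB s = map (λ t → (proj₁ t , proj₁ s , proj₁ (proj₂ t) , proj₂ (proj₂ t))) (ΔB (proj₂ s))

-- On basis elements coassociativity is that of deconcatenation.
Δ-coassocB : ∀ u → Δ⊗id (ΔB u) ≋₃ id⊗Δ (ΔB u)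
Δ-coassocB u = begin
    Δ⊗id (ΔB u)
      ≡⟨ cong Δ⊗id (ΔB-splits u) ⟩
    Δ⊗id (ones (splits u))
      ≈⟨ lin-ones-ones (λ s → map (λ t → (proj₁ t , proj₂ t , proj₂ s)) (splits (proj₁ s)))
                        (λ s → ≋-reflexive (relabel (splits (proj₁ s)) (ΔB-splits (proj₁ s)))) (splits u) ⟩
    ones (cutsLeft u)
      ≈⟨ ↭⇒≋ (map⁺ (1ℚ ,_) (splits-coassoc u)) ⟩
    ones (cutsRight u)
      ≈⟨ lin-ones-ones (λ s → map (λ t → (proj₁ s , proj₁ t , proj₂ t)) (splits (proj₂ s)))
                        (λ s → ≋-reflexive (relabel (splits (proj₂ s)) (ΔB-splits (proj₂ s)))) (splits u) ⟨
    id⊗Δ (ones (splits u))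
      ≡⟨ cong id⊗Δ (ΔB-splits u) ⟨
    id⊗Δ (ΔB u) ∎
  where
    open Combinations _≟₃_
    open ≋-Reasoning
    relabel : ∀ {A B : Set} {g : A → B} (L : List A) {X} → X ≡ ones L →
              map (λ t → (proj₁ t , g (proj₂ t))) X ≡ ones (map g L)
    relabel L refl = trans (sym (LP.map-∘ L)) (LP.map-∘ L)

Δ-coassociative : ∀ x → Δ⊗id (Δ x) ≈₃ id⊗Δ (Δ x)
Δ-coassociative x = coeff-≡ (begin
    Δ⊗id (Δ x)                   ≈⟨ lin-lin Δ⊗idB ΔB x ⟩
    lin (λ u → Δ⊗id (ΔB u)) x    ≈⟨ lin-cong Δ-coassocB x ⟩
    lin (λ u → id⊗Δ (ΔB u)) x    ≈⟨ lin-lin id⊗ΔB ΔB x ⟨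
    id⊗Δ (Δ x)                   ∎)
  where
    open Combinations _≟₃_
    open ≋-Reasoning

-- The counit on the left of a split (a , b) is nonzero only for a = [].
counitˡ-splits : ∀ u → concatMap (λ s → (εB (proj₁ s) , proj₂ s) ∷ []) (splits u) ≋₁ basis u
counitˡ-splits []      = ≋-refl
  where open Combinations _≟Basis_
counitˡ-splits (x ∷ w) = ≋-++ {basis (x ∷ w)} ≋-refl (≋-trans
    (≋-reflexive (LP.concatMap-map (λ s → (εB (proj₁ s) , proj₂ s) ∷ []) (push x) (splits w)))
    (zeros-vanish proj₂ (splits w)))
  where open Combinations _≟Basis_

-- The counit on the right of a split (a , b) is nonzero only for b = [];
-- proved for sums in which a fixed word p is put in front of a.
counitʳ-splits : ∀ p u → concatMap (λ s → (εB (proj₂ s) , p ++ proj₁ s) ∷ []) (splits u) ≋₁ basis (p ++ u)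
counitʳ-splits p []      = ≋-refl
  where open Combinations _≟Basis_
counitʳ-splits p (x ∷ w) = begin
    concatMap (λ s → (εB (proj₂ s) , p ++ proj₁ s) ∷ []) (splits (x ∷ w))
      ≡⟨ splits-prefixed (λ a b → (εB b , a) ∷ []) p x w ⟩
    (0ℚ , p) ∷ concatMap (λ s → (εB (proj₂ s) , (p ++ x ∷ []) ++ proj₁ s) ∷ []) (splits w)
      ≈⟨ drop-zero p _ ⟩
    concatMap (λ s → (εB (proj₂ s) , (p ++ x ∷ []) ++ proj₁ s) ∷ []) (splits w)
      ≈⟨ counitʳ-splits (p ++ x ∷ []) w ⟩
    basis ((p ++ x ∷ []) ++ w)
      ≡⟨ cong basis (LP.++-assoc p (x ∷ []) w) ⟩
    basis (p ++ x ∷ w) ∎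
  where
    open Combinations _≟Basis_
    open ≋-Reasoning

ε⊗idB id⊗εB : Basis × Basis → V
ε⊗idB s = (εB (proj₁ s) , proj₂ s) ∷ []
id⊗εB s = (εB (proj₂ s) , proj₁ s) ∷ []

left-counit : ∀ x → ε⊗id (Δ x) ≈ x
left-counit = coeff-≡ ∘ lin-retraction ε⊗idB ΔB (λ u → ≋-trans (lin-ΔB ε⊗idB u) (counitˡ-splits u))
  where open Combinations _≟Basis_

right-counit : ∀ x → id⊗ε (Δ x) ≈ x
right-counit = coeff-≡ ∘ lin-retraction id⊗εB ΔB (λ u → ≋-trans (lin-ΔB id⊗εB u) (counitʳ-splits [] u))
  where open Combinations _≟Basis_

mulB⊗mulB : Basis × Basis → Basis × Basis → V₂
mulB⊗mulB p q = tens (mulB (proj₁ p) (proj₁ q)) (mulB (proj₂ p) (proj₂ q))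

tens-ones : ∀ (X Y : List Basis) → tens (ones X) (ones Y) ≡ ones (cartesianProduct X Y)
tens-ones []      Y = refl
tens-ones (a ∷ X) Y = trans (cong₂ _++_ (trans (sym (LP.map-∘ Y)) (LP.map-∘ Y)) (tens-ones X Y))
                            (sym (LP.map-++ (1ℚ ,_) (map (a ,_) Y) (cartesianProduct X Y)))

mulB⊗mulB-shufflePairs : ∀ p q →
  mulB⊗mulB p q ≡ ones (shufflePairs (nullFace (proj₁ p) , nullFace (proj₂ p)) q)
mulB⊗mulB-shufflePairs p q =
  trans (cong₂ tens (mulB-shuffles (proj₁ p) (proj₁ q)) (mulB-shuffles (proj₂ p) (proj₂ q)))
        (tens-ones (shuffles (nullFace (proj₁ p)) (proj₁ q)) (shuffles (nullFace (proj₂ p)) (proj₂ q)))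

-- On basis elements, Δ(F_u · F_v) = Δ(F_u) · Δ(F_v) is the
-- multiplicativity of deconcatenation for shuffles.
Δ-mulB : ∀ u v → lin ΔB (mulB u v) ≋₂ bilin mulB⊗mulB (ΔB u) (ΔB v)
Δ-mulB u v = begin
    lin ΔB (mulB u v)
      ≡⟨ cong (lin ΔB) (mulB-shuffles u v) ⟩
    lin ΔB (ones (shuffles (nullFace u) v))
      ≈⟨ lin-ones-ones splits (λ w → ≋-reflexive (ΔB-splits w)) (shuffles (nullFace u) v) ⟩
    ones (concatMap splits (shuffles (nullFace u) v))
      ≈⟨ ↭⇒≋ (map⁺ (1ℚ ,_) (splits-shuffles (nullFace u) v)) ⟩
    ones (splitThenShuffle (nullFace u) v)
      ≡⟨ cong ones (trans (cong (concatMap (shufflePairsWithSplits v)) (splits-map _ u))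
                          (LP.concatMap-map (shufflePairsWithSplits v) _ (splits u))) ⟩
    ones (concatMap (λ p → concatMap (shufflePairs (nullFace (proj₁ p) , nullFace (proj₂ p))) (splits v)) (splits u))
      ≈⟨ bilin-ones _ (λ p q → ≋-reflexive (mulB⊗mulB-shufflePairs p q)) (splits u) (splits v) ⟨
    bilin mulB⊗mulB (ones (splits u)) (ones (splits v))
      ≡⟨ cong₂ (bilin mulB⊗mulB) (ΔB-splits u) (ΔB-splits v) ⟨
    bilin mulB⊗mulB (ΔB u) (ΔB v) ∎
  where
    open Combinations _≟₂_
    open ≋-Reasoning

Δ-multiplicative : ∀ x y → Δ (x · y) ≈₂ (Δ x ·₂ Δ y)
Δ-multiplicative x y = coeff-≡ (begin
    Δ (x · y)                                              ≈⟨ lin-bilin ΔB mulB x y ⟩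
    bilin (λ u v → lin ΔB (mulB u v)) x y                  ≈⟨ bilin-cong Δ-mulB x y ⟩
    bilin (λ u v → bilin mulB⊗mulB (ΔB u) (ΔB v)) x y      ≈⟨ bilin-lin mulB⊗mulB ΔB ΔB x y ⟨
    Δ x ·₂ Δ y                                             ∎)
  where
    open Combinations _≟₂_
    open ≋-Reasoning

ε-positive : ∀ {n} {x : V} → All (λ t → deg (proj₂ t) ≡ suc n) x → linℚ εB x ≡ 0ℚ
ε-positive []                      = refl
ε-positive {x = (c , _ ∷ _) ∷ x} (_ ∷ ps) =
  trans (cong (c *ℚ 0ℚ +ℚ_) (ε-positive ps)) (trans (ℚP.+-identityʳ _) (ℚP.*-zeroʳ c))

-- ε is multiplicative on basis elements: a product has positive degree
-- as soon as one factor does.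
ε-mulB : ∀ u v → linℚ εB (mulB u v) ≡ εB u *ℚ εB v
ε-mulB []      []      = refl
ε-mulB []      (y ∷ v) = refl
ε-mulB (x ∷ u) v       = trans (ε-positive (mulB-graded (x ∷ u) v)) (sym (ℚP.*-zeroˡ (εB v)))

ε-multiplicative : ∀ x y → ε (x · y) ≡ ε x *ℚ ε y
ε-multiplicative x y = begin
    linℚ εB (bilin mulB x y)
      ≡⟨ linℚ-lin εB (λ u → lin (mulB u) y) x ⟩
    linℚ (λ u → linℚ εB (lin (mulB u) y)) x
      ≡⟨ linℚ-cong (λ u → trans (linℚ-lin εB (mulB u) y) (linℚ-cong (ε-mulB u) y)) x ⟩
    linℚ (λ u → linℚ (λ v → εB u *ℚ εB v) y) x
      ≡⟨ linℚ-cong (λ u → linℚ-*ˡ εB (εB u) y) x ⟩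
    linℚ (λ u → εB u *ℚ ε y) x
      ≡⟨ linℚ-*ʳ εB (ε y) x ⟩
    ε x *ℚ ε y ∎
  where open ≡-Reasoning

mutual
  antipode : Basis → V
  antipode []      = one
  antipode (x ∷ u) = neg (properSplitSum [] (x ∷ u))

  -- properSplitSum p u = Σ_{u = a b, a ≠ []} F_{p a} · S(F_b).
  properSplitSum : Basis → Basis → V
  properSplitSum p []      = []
  properSplitSum p (x ∷ u) = lin (mulB (p ++ x ∷ [])) (antipode u) ++ properSplitSum (p ++ x ∷ []) u

convolutionTerm : Basis × Basis → V
convolutionTerm s = lin (mulB (proj₁ s)) (antipode (proj₂ s))

splitSum-prefixed : ∀ p u →
  concatMap (λ s → lin (mulB (p ++ proj₁ s)) (antipode (proj₂ s))) (splits u) ≋₁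
  lin (mulB p) (antipode u) ++ properSplitSum p u
splitSum-prefixed p []      = ≋-reflexive (cong (λ q → lin (mulB q) one ++ []) (LP.++-identityʳ p))
  where open Combinations _≟Basis_
splitSum-prefixed p (x ∷ w) = begin
    concatMap (λ s → lin (mulB (p ++ proj₁ s)) (antipode (proj₂ s))) (splits (x ∷ w))
      ≡⟨ splits-prefixed (λ a b → lin (mulB a) (antipode b)) p x w ⟩
    lin (mulB p) (antipode (x ∷ w))
      ++ concatMap (λ s → lin (mulB ((p ++ x ∷ []) ++ proj₁ s)) (antipode (proj₂ s))) (splits w)
      ≈⟨ ≋-++ {lin (mulB p) (antipode (x ∷ w))} ≋-refl (splitSum-prefixed (p ++ x ∷ []) w) ⟩
    lin (mulB p) (antipode (x ∷ w)) ++ properSplitSum p (x ∷ w) ∎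
  where
    open Combinations _≟Basis_
    open ≋-Reasoning

antipodeB : ∀ u → concatMap convolutionTerm (splits u) ≋₁ η (εB u)
antipodeB []      = ≋-refl
  where open Combinations _≟Basis_
antipodeB (x ∷ w) = begin
    concatMap convolutionTerm (splits (x ∷ w))
      ≈⟨ splitSum-prefixed [] (x ∷ w) ⟩
    lin basis (neg G) ++ G
      ≈⟨ ≋-++ (lin-basis (neg G)) ≋-refl ⟩
    neg G ++ G
      ≈⟨ neg-cancel G ⟩
    []
      ≈⟨ drop-zero [] [] ⟨
    η 0ℚ ∎
  where
    open Combinations _≟Basis_
    open ≋-Reasoning
    G = properSplitSum [] (x ∷ w)

antipode-property : ∀ x → id⋆ antipode x ≈ η (ε x)
antipode-property x = coeff-≡ (begin
    id⋆ antipode x                            ≈⟨ lin-lin convolutionTerm ΔB x ⟩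
    lin (λ u → lin convolutionTerm (ΔB u)) x  ≈⟨ lin-cong (λ u → ≋-trans (lin-ΔB convolutionTerm u) (antipodeB u)) x ⟩
    lin (λ u → η (εB u)) x                    ≈⟨ lin-single εB [] x ⟩
    η (ε x)                                   ∎)
  where
    open Combinations _≟Basis_
    open ≋-Reasoning

theorem7p11 : GradedBialgebra × HasOneSidedAntipode
theorem7p11 = record
  { mul-graded   = mulB-graded
  ; Δ-graded     = ΔB-graded
  ; mul-assoc    = ·-assoc
  ; unit-left    = one-·
  ; Δ-coassoc    = Δ-coassociative
  ; counit-left  = left-counit
  ; counit-right = right-counit
  ; Δ-mul        = Δ-multiplicative
  ; Δ-one        = λ _ → refl
  ; ε-mul        = ε-multiplicative
  ; ε-one        = refl
  } , (antipode , antipode-property)
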